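{- In a penny graph with vertices in general position, if $B_1,B_2,B_3,B_4$ are distinct vertices such that $B_1B_2$, $B_2B_3$, $B_3B_4$ are edges, then the convex hull of $\{B_1,B_2,B_3,B_4\}$ contains no other vertex of the graph.
   Context: A penny graph is a graph whose vertex set is a finite set $P$ of points in the Euclidean plane such that every two distinct points of $P$ are at distance at least $1$, and whose edges are exactly the pairs of points of $P$ at distance exactly $1$. The vertices are in general position if no three of them are collinear. -}

module Defs where

open import Level using (0ℓ)
open import Algebra.Bundles using (CommutativeRing)
open import Relation.Binary.Structures using (IsStrictTotalOrder)
open import Relation.Nullary using (¬_)
open import Data.Product using (_×_; _,_; ∃; Σ)
open import Data.Sum using (_⊎_)
open import Data.Fin using (Fin)
open import Relation.Binary.PropositionalEquality using (_≡_)

-- A complete ordered field (= the real numbers, unique up to isomorphism).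
-- The statement quantifies over an arbitrary such structure, since agda-stdlib
-- has no real numbers.
record CompleteOrderedField : Set₁ where
  field
    commRing : CommutativeRing 0ℓ 0ℓ
  open CommutativeRing commRing public hiding (ring)
  field
    _<_ : Carrier → Carrier → Set
    <-isStrictTotalOrder : IsStrictTotalOrder _≈_ _<_
    1≉0 : ¬ (1# ≈ 0#)
    inverse : ∀ x → ¬ (x ≈ 0#) → ∃ λ y → x * y ≈ 1#
    +-mono-< : ∀ {x y} z → x < y → (x + z) < (y + z)
    *-pos : ∀ {x y} → 0# < x → 0# < y → 0# < (x * y)

  infix 4 _≤_
  _≤_ : Carrier → Carrier → Set
  x ≤ y = (x < y) ⊎ (x ≈ y)

  UpperBound : (Carrier → Set) → Carrier → Set
  UpperBound S b = ∀ x → S x → x ≤ b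

  field
    complete : (S : Carrier → Set) → ∃ S → ∃ (UpperBound S) →
               ∃ λ s → UpperBound S s × (∀ b → UpperBound S b → s ≤ b)

module Plane (R : CompleteOrderedField) where
  open CompleteOrderedField R

  Point : Set
  Point = Carrier × Carrier

  sq : Carrier → Carrier
  sq x = x * x

  -- squared Euclidean distance |PQ|²  (|PQ| ≥ 1 ⇔ |PQ|² ≥ 1, |PQ| = 1 ⇔ |PQ|² = 1)
  dist² : Point → Point → Carrier
  dist² (x₁ , y₁) (x₂ , y₂) = sq (x₁ - x₂) + sq (y₁ - y₂)

  Collinear : Point → Point → Point → Set
  Collinear (ax , ay) (bx , by) (cx , cy) =
    ((bx - ax) * (cy - ay)) ≈ ((by - ay) * (cx - ax))

  IsPennyConfiguration : ∀ {n} → (Fin n → Point) → Set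
  IsPennyConfiguration {n} p = ∀ (i j : Fin n) → ¬ (i ≡ j) → 1# ≤ dist² (p i) (p j)

  Edge : ∀ {n} → (Fin n → Point) → Fin n → Fin n → Set
  Edge p i j = dist² (p i) (p j) ≈ 1#

  GeneralPosition : ∀ {n} → (Fin n → Point) → Set
  GeneralPosition {n} p = ∀ (i j k : Fin n) → ¬ (i ≡ j) → ¬ (j ≡ k) → ¬ (i ≡ k) →
                          ¬ Collinear (p i) (p j) (p k)

  InConvexHull4 : Point → Point → Point → Point → Point → Set
  InConvexHull4 (x , y) (ax , ay) (bx , by) (cx , cy) (dx , dy) =
    Σ Carrier λ a → Σ Carrier λ b → Σ Carrier λ c → Σ Carrier λ d →
      (0# ≤ a) × (0# ≤ b) × (0# ≤ c) × (0# ≤ d) ×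
      ((a + b + c + d) ≈ 1#) ×
      (x ≈ (a * ax + b * bx + c * cx + d * dx)) ×
      (y ≈ (a * ay + b * by + c * cy + d * dy))

-- Put the enclosed vertex v at the origin, let uᵢ = pᵢ − v (so |uᵢ| ≥ 1) and w = u₂ + u₃.  In a
-- triangle with two sides of length ≥ 1 from the origin and a unit third side the angle at the
-- origin is at most 60°, and the angle between u₂ and u₂ + u₃ is at most 30°; hence u₁ and w make
-- an angle of at most 90°, i.e. u₁ · w ≥ 0, symmetrically u₄ · w ≥ 0, while u₂ · w, u₃ · w > 0.
-- Writing v = a p₁ + b p₂ + c p₃ + d p₄ as a convex combination, a u₁ + b u₂ + c u₃ + d u₄ = 0, and
-- its dot product with w forces b = c = 0: v lies on the segment p₁p₄, against general position.  Angles are handled through tangents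
-- (u ∧ u′)/(u · u′), so that only polynomial inequalities in an ordered ring remain.
module Submission where

open import Defs
open import Data.Nat using (ℕ)
open import Data.Fin using (Fin)
open import Relation.Nullary using (¬_)
open import Relation.Binary.PropositionalEquality using (_≡_)

open import Level using (0ℓ)
open import Algebra.Bundles using (CommutativeRing)
import Algebra.Solver.Ring
open import Algebra.Solver.Ring.AlmostCommutativeRing
  using (fromCommutativeRing; _-Raw-AlmostCommutative⟶_)
open import Data.Empty using (⊥-elim)
open import Data.Integer.Base as ℤ using (ℤ; +_; -[1+_]; _⊖_)
import Data.Integer.Properties as ℤ
open import Data.Maybe.Base using (Maybe; just; nothing)
open import Data.Nat.Base as ℕ using (zero; suc)
import Data.Nat.Properties as ℕ
open import Data.Product.Base using (_×_; _,_; proj₁; proj₂)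
open import Data.Sign.Base as Sign using (Sign)
open import Data.Sum.Base using (_⊎_; inj₁; inj₂)
open import Relation.Binary.Definitions using (tri<; tri≈; tri>)
open import Relation.Binary.Structures using (IsStrictTotalOrder)
open import Relation.Nullary.Decidable using (yes; no)
import Relation.Binary.PropositionalEquality as ≡

module IntegerCoefficientSolver {c ℓ} (R : CommutativeRing c ℓ) where
  open CommutativeRing R
  open import Algebra.Properties.Ring ring using (-1*x≈-x; -0#≈0#; -‿involutive)
  open import Algebra.Properties.AbelianGroup +-abelianGroup using (⁻¹-∙-comm)
  open import Algebra.Properties.CommutativeSemigroup *-commutativeSemigroup
    using () renaming (interchange to *-interchange)
  open import Algebra.Properties.CommutativeSemigroup +-commutativeSemigroup
    using () renaming (interchange to +-interchange)
  open import Algebra.Properties.Semiring.Mult.TCOptimised semiring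
    using (1+×; ×-homo-+; ×1-homo-*) renaming (_×_ to _×′_)
  open import Relation.Binary.Reasoning.Setoid setoid

  -- With the optimised _×′_, the constant ⟦ + 1 ⟧ is 1# and ⟦ + 3 ⟧ is 1# + 1# + 1# on the nose,
  -- so solver constants agree definitionally with numerals written in the ring.
  ⟦_⟧ : ℤ → Carrier
  ⟦ + n ⟧      = n ×′ 1#
  ⟦ -[1+ n ] ⟧ = - (suc n ×′ 1#)

  ⟦_⟧ₛ : Sign → Carrier
  ⟦ Sign.+ ⟧ₛ = 1#
  ⟦ Sign.- ⟧ₛ = - 1#

  ⊖-homo : ∀ m n → ⟦ m ⊖ n ⟧ ≈ m ×′ 1# - n ×′ 1#
  ⊖-homo m zero = begin
    ⟦ m ⊖ 0 ⟧      ≡⟨ ≡.cong ⟦_⟧ (ℤ.⊖-≥ {m} ℕ.z≤n) ⟩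
    m ×′ 1#        ≈⟨ +-identityʳ _ ⟨
    m ×′ 1# + 0#   ≈⟨ +-congˡ -0#≈0# ⟨
    m ×′ 1# - 0#   ∎
  ⊖-homo zero (suc n) = sym (+-identityˡ _)
  ⊖-homo (suc m) (suc n) = begin
    ⟦ suc m ⊖ suc n ⟧                  ≡⟨ ≡.cong ⟦_⟧ (ℤ.[1+m]⊖[1+n]≡m⊖n m n) ⟩
    ⟦ m ⊖ n ⟧                          ≈⟨ ⊖-homo m n ⟩
    m ×′ 1# - n ×′ 1#                  ≈⟨ +-identityˡ _ ⟨
    0# + (m ×′ 1# - n ×′ 1#)           ≈⟨ +-congʳ (-‿inverseʳ 1#) ⟨
    (1# - 1#) + (m ×′ 1# - n ×′ 1#)    ≈⟨ +-interchange 1# (m ×′ 1#) (- 1#) (- (n ×′ 1#)) ⟨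
    (1# + m ×′ 1#) + (- 1# - n ×′ 1#)  ≈⟨ +-congˡ (⁻¹-∙-comm 1# (n ×′ 1#)) ⟩
    (1# + m ×′ 1#) - (1# + n ×′ 1#)    ≈⟨ +-cong (1+× m 1#) (-‿cong (1+× n 1#)) ⟨
    suc m ×′ 1# - suc n ×′ 1#          ∎

  +-homo : ∀ i j → ⟦ i ℤ.+ j ⟧ ≈ ⟦ i ⟧ + ⟦ j ⟧
  +-homo (+ m)    (+ n)    = ×-homo-+ 1# m n
  +-homo (+ m)    -[1+ n ] = ⊖-homo m (suc n)
  +-homo -[1+ m ] (+ n)    = trans (⊖-homo n (suc m)) (+-comm _ _)
  +-homo -[1+ m ] -[1+ n ] = begin
    - (suc (suc (m ℕ.+ n)) ×′ 1#)        ≡⟨ ≡.cong (λ k → - (suc k ×′ 1#)) (ℕ.+-suc m n) ⟨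
    - ((suc m ℕ.+ suc n) ×′ 1#)          ≈⟨ -‿cong (×-homo-+ 1# (suc m) (suc n)) ⟩
    - (suc m ×′ 1# + suc n ×′ 1#)        ≈⟨ ⁻¹-∙-comm _ _ ⟨
    - (suc m ×′ 1#) - suc n ×′ 1#        ∎

  ◃-homo : ∀ s n → ⟦ s ℤ.◃ n ⟧ ≈ ⟦ s ⟧ₛ * n ×′ 1#
  ◃-homo s        zero    = sym (zeroʳ _)
  ◃-homo Sign.+ (suc n) = sym (*-identityˡ _)
  ◃-homo Sign.- (suc n) = sym (-1*x≈-x _)

  sign-abs : ∀ i → ⟦ i ⟧ ≈ ⟦ ℤ.sign i ⟧ₛ * ℤ.∣ i ∣ ×′ 1#
  sign-abs (+ n)    = sym (*-identityˡ _)
  sign-abs -[1+ n ] = sym (-1*x≈-x _)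

  sign-*-homo : ∀ s t → ⟦ s Sign.* t ⟧ₛ ≈ ⟦ s ⟧ₛ * ⟦ t ⟧ₛ
  sign-*-homo Sign.+ t      = sym (*-identityˡ _)
  sign-*-homo Sign.- Sign.+ = sym (*-identityʳ _)
  sign-*-homo Sign.- Sign.- = sym (trans (-1*x≈-x (- 1#)) (-‿involutive 1#))

  *-homo : ∀ i j → ⟦ i ℤ.* j ⟧ ≈ ⟦ i ⟧ * ⟦ j ⟧
  *-homo i j = begin
    ⟦ s Sign.* t ℤ.◃ m ℕ.* n ⟧              ≈⟨ ◃-homo (s Sign.* t) (m ℕ.* n) ⟩
    ⟦ s Sign.* t ⟧ₛ * (m ℕ.* n) ×′ 1#        ≈⟨ *-cong (sign-*-homo s t) (×1-homo-* m n) ⟩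
    (⟦ s ⟧ₛ * ⟦ t ⟧ₛ) * (m ×′ 1# * n ×′ 1#) ≈⟨ *-interchange _ _ _ _ ⟩
    (⟦ s ⟧ₛ * m ×′ 1#) * (⟦ t ⟧ₛ * n ×′ 1#) ≈⟨ *-cong (sign-abs i) (sign-abs j) ⟨
    ⟦ i ⟧ * ⟦ j ⟧                           ∎
    where s = ℤ.sign i; t = ℤ.sign j; m = ℤ.∣ i ∣; n = ℤ.∣ j ∣

  -‿homo : ∀ i → ⟦ ℤ.- i ⟧ ≈ - ⟦ i ⟧
  -‿homo (+ zero)  = sym -0#≈0#
  -‿homo (+ suc n) = refl
  -‿homo -[1+ n ]  = sym (-‿involutive _)

  homomorphism : ℤ.+-*-rawRing -Raw-AlmostCommutative⟶ fromCommutativeRing R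
  homomorphism = record
    { ⟦_⟧ = ⟦_⟧ ; +-homo = +-homo ; *-homo = *-homo ; -‿homo = -‿homo
    ; 0-homo = refl ; 1-homo = refl }

  ⟦⟧-weaklyDecidable : ∀ i j → Maybe (⟦ i ⟧ ≈ ⟦ j ⟧)
  ⟦⟧-weaklyDecidable i j with i ℤ.≟ j
  ... | yes ≡.refl = just refl
  ... | no _       = nothing

  open Algebra.Solver.Ring ℤ.+-*-rawRing (fromCommutativeRing R) homomorphism ⟦⟧-weaklyDecidable public
    using (Polynomial; solve; _:=_; _:+_; _:*_; _:-_; :-_; con)

record OrderedCommutativeRing : Set₁ where
  field
    commRing : CommutativeRing 0ℓ 0ℓ
  open CommutativeRing commRing public
  infix 4 _<_ _≤_
  field
    _<_ : Carrier → Carrier → Set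
    <-isStrictTotalOrder : IsStrictTotalOrder _≈_ _<_
    1≉0 : ¬ (1# ≈ 0#)
    +-mono-< : ∀ {x y} z → x < y → x + z < y + z
    *-pos : ∀ {x y} → 0# < x → 0# < y → 0# < x * y

  _≤_ : Carrier → Carrier → Set
  x ≤ y = (x < y) ⊎ (x ≈ y)

orderedCommutativeRing : CompleteOrderedField → OrderedCommutativeRing
orderedCommutativeRing R = record
  { commRing = commRing
  ; _<_ = _<_
  ; <-isStrictTotalOrder = <-isStrictTotalOrder
  ; 1≉0 = 1≉0
  ; +-mono-< = +-mono-<
  ; *-pos = *-pos
  }
  where open CompleteOrderedField R

module OrderedCommutativeRingProperties (R : OrderedCommutativeRing) where
  open OrderedCommutativeRing R
  open IsStrictTotalOrder <-isStrictTotalOrder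
    using (compare; irrefl; <-respˡ-≈; <-respʳ-≈) renaming (trans to <-trans)
  open IntegerCoefficientSolver commRing public using (Polynomial; solve; _:=_; _:+_; _:*_; _:-_; :-_; con)

  y-x+x≈y : ∀ x y → y - x + x ≈ y
  y-x+x≈y = solve 2 (λ x y → y :- x :+ x := y) refl

  2# 3# 4# : Carrier
  2# = 1# + 1#
  3# = 2# + 1#
  4# = 3# + 1#

  <-resp₂ : ∀ {x x′ y y′} → x ≈ x′ → y ≈ y′ → x < y → x′ < y′
  <-resp₂ x≈x′ y≈y′ x<y = <-respʳ-≈ y≈y′ (<-respˡ-≈ x≈x′ x<y)

  ≤-resp₂ : ∀ {x x′ y y′} → x ≈ x′ → y ≈ y′ → x ≤ y → x′ ≤ y′
  ≤-resp₂ x≈x′ y≈y′ (inj₁ x<y) = inj₁ (<-resp₂ x≈x′ y≈y′ x<y)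
  ≤-resp₂ x≈x′ y≈y′ (inj₂ x≈y) = inj₂ (trans (sym x≈x′) (trans x≈y y≈y′))

  <-≤-trans : ∀ {x y z} → x < y → y ≤ z → x < z
  <-≤-trans x<y (inj₁ y<z) = <-trans x<y y<z
  <-≤-trans x<y (inj₂ y≈z) = <-respʳ-≈ y≈z x<y

  ≤-trans : ∀ {x y z} → x ≤ y → y ≤ z → x ≤ z
  ≤-trans (inj₁ x<y) y≤z = inj₁ (<-≤-trans x<y y≤z)
  ≤-trans (inj₂ x≈y) y≤z = ≤-resp₂ (sym x≈y) refl y≤z

  <⇒≱ : ∀ {x y} → x < y → ¬ (y ≤ x)
  <⇒≱ x<y y≤x = irrefl refl (<-≤-trans x<y y≤x)

  x<y⇒0<y-x : ∀ {x y} → x < y → 0# < y - x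
  x<y⇒0<y-x {x} x<y = <-resp₂ (-‿inverseʳ x) refl (+-mono-< (- x) x<y)

  x≤y⇒0≤y-x : ∀ {x y} → x ≤ y → 0# ≤ y - x
  x≤y⇒0≤y-x (inj₁ x<y) = inj₁ (x<y⇒0<y-x x<y)
  x≤y⇒0≤y-x {x} (inj₂ x≈y) = inj₂ (trans (sym (-‿inverseʳ x)) (+-congʳ x≈y))

  0<y-x⇒x<y : ∀ {x y} → 0# < y - x → x < y
  0<y-x⇒x<y {x} {y} 0<y-x = <-resp₂ (+-identityˡ x) (y-x+x≈y x y) (+-mono-< x 0<y-x)

  0≤y-x⇒x≤y : ∀ {x y} → 0# ≤ y - x → x ≤ y
  0≤y-x⇒x≤y (inj₁ 0<y-x) = inj₁ (0<y-x⇒x<y 0<y-x)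
  0≤y-x⇒x≤y {x} {y} (inj₂ 0≈y-x) = inj₂ (trans (sym (+-identityˡ x)) (trans (+-congʳ 0≈y-x) (y-x+x≈y x y)))

  neg-pos : ∀ {x} → x < 0# → 0# < - x
  neg-pos x<0 = <-resp₂ refl (+-identityˡ _) (x<y⇒0<y-x x<0)

  +-pos-nonneg : ∀ {x y} → 0# < x → 0# ≤ y → 0# < x + y
  +-pos-nonneg {x} 0<x (inj₁ 0<y) = <-trans 0<x (<-resp₂ (+-identityˡ x) (+-comm _ x) (+-mono-< x 0<y))
  +-pos-nonneg {x} 0<x (inj₂ 0≈y) = <-resp₂ refl (trans (sym (+-identityʳ x)) (+-congˡ 0≈y)) 0<x

  +-nonneg : ∀ {x y} → 0# ≤ x → 0# ≤ y → 0# ≤ x + y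
  +-nonneg (inj₁ 0<x) 0≤y = inj₁ (+-pos-nonneg 0<x 0≤y)
  +-nonneg {x} {y} (inj₂ 0≈x) 0≤y = ≤-resp₂ refl (trans (sym (+-identityˡ y)) (+-congʳ 0≈x)) 0≤y

  *-nonneg : ∀ {x y} → 0# ≤ x → 0# ≤ y → 0# ≤ x * y
  *-nonneg (inj₁ 0<x) (inj₁ 0<y) = inj₁ (*-pos 0<x 0<y)
  *-nonneg {x} 0≤x (inj₂ 0≈y) = inj₂ (trans (sym (zeroʳ x)) (*-congˡ 0≈y))
  *-nonneg {x} {y} (inj₂ 0≈x) 0≤y = inj₂ (trans (sym (zeroˡ y)) (*-congʳ 0≈x))

  *-pos-neg : ∀ {x y} → 0# < x → y < 0# → x * y < 0#
  *-pos-neg {x} {y} 0<x y<0 = <-resp₂ (+-identityˡ _) (solve 2 (λ x y → :- (x :* y) :+ x :* y := con (+ 0)) refl x y)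
    (+-mono-< (x * y) (<-resp₂ refl (solve 2 (λ x y → x :* (:- y) := :- (x :* y)) refl x y) (*-pos 0<x (neg-pos y<0))))

  square-nonneg : ∀ x → 0# ≤ x * x
  square-nonneg x with compare 0# x
  ... | tri< 0<x _ _ = inj₁ (*-pos 0<x 0<x)
  ... | tri≈ _ 0≈x _ = *-nonneg (inj₂ 0≈x) (inj₂ 0≈x)
  ... | tri> _ _ x<0 = inj₁ (<-resp₂ refl (solve 1 (λ x → (:- x) :* (:- x) := x :* x) refl x) (*-pos (neg-pos x<0) (neg-pos x<0)))

  0<1 : 0# < 1#
  0<1 with compare 0# 1#
  ... | tri< 0<1 _ _ = 0<1
  ... | tri≈ _ 0≈1 _ = ⊥-elim (1≉0 (sym 0≈1))
  ... | tri> _ _ 1<0 = ⊥-elim (<⇒≱ 1<0 (≤-resp₂ refl (*-identityˡ 1#) (square-nonneg 1#)))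

  0<2# : 0# < 2#
  0<2# = +-pos-nonneg 0<1 (inj₁ 0<1)

  0<3# : 0# < 3#
  0<3# = +-pos-nonneg 0<2# (inj₁ 0<1)

  0<4# : 0# < 4#
  0<4# = +-pos-nonneg 0<3# (inj₁ 0<1)

  1≤x⇒0<x : ∀ {x} → 1# ≤ x → 0# < x
  1≤x⇒0<x = <-≤-trans 0<1

  *-cancelˡ-pos : ∀ {c x} → 0# < c → 0# < c * x → 0# < x
  *-cancelˡ-pos {c} {x} 0<c 0<cx with compare 0# x
  ... | tri< 0<x _ _ = 0<x
  ... | tri≈ _ 0≈x _ = ⊥-elim (irrefl (trans (sym (zeroʳ c)) (*-congˡ 0≈x)) 0<cx)
  ... | tri> _ _ x<0 = ⊥-elim (irrefl refl (<-trans 0<cx (*-pos-neg 0<c x<0)))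

  *-cancelˡ-nonneg : ∀ {c x} → 0# < c → 0# ≤ c * x → 0# ≤ x
  *-cancelˡ-nonneg {c} {x} 0<c 0≤cx with compare 0# x
  ... | tri< 0<x _ _ = inj₁ 0<x
  ... | tri≈ _ 0≈x _ = inj₂ 0≈x
  ... | tri> _ _ x<0 = ⊥-elim (<⇒≱ (*-pos-neg 0<c x<0) 0≤cx)

  *-monoˡ-≤-nonneg : ∀ {x y z} → 0# ≤ z → x ≤ y → z * x ≤ z * y
  *-monoˡ-≤-nonneg {x} {y} {z} 0≤z x≤y = 0≤y-x⇒x≤y
    (≤-resp₂ refl (solve 3 (λ x y z → z :* (y :- x) := z :* y :- z :* x) refl x y z) (*-nonneg 0≤z (x≤y⇒0≤y-x x≤y)))

  *-mono-≤-nonneg : ∀ {x y u v} → 0# ≤ x → 0# ≤ u → x ≤ y → u ≤ v → x * u ≤ y * v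
  *-mono-≤-nonneg {x} {y} {u} {v} 0≤x 0≤u x≤y u≤v = ≤-trans
    (≤-resp₂ (*-comm u x) (*-comm u y) (*-monoˡ-≤-nonneg 0≤u x≤y))
    (*-monoˡ-≤-nonneg (≤-trans 0≤x x≤y) u≤v)

  *-cancelˡ-≤-pos : ∀ {x y z} → 0# < z → z * x ≤ z * y → x ≤ y
  *-cancelˡ-≤-pos {x} {y} {z} 0<z zx≤zy = 0≤y-x⇒x≤y (*-cancelˡ-nonneg 0<z
    (≤-resp₂ refl (solve 3 (λ x y z → z :* y :- z :* x := z :* (y :- x)) refl x y z) (x≤y⇒0≤y-x zx≤zy)))

  x*x≤y*y⇒0≤y+x : ∀ {x y} → 0# < y → x * x ≤ y * y → 0# ≤ y + x
  x*x≤y*y⇒0≤y+x {x} {y} 0<y xx≤yy with compare 0# (y + x)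
  ... | tri< 0<y+x _ _ = inj₁ 0<y+x
  ... | tri≈ _ 0≈y+x _ = inj₂ 0≈y+x
  ... | tri> _ _ y+x<0 = ⊥-elim (<⇒≱ (0<y-x⇒x<y 0<xx-yy) xx≤yy)
    where
    0<y-x : 0# < y - x
    0<y-x = <-resp₂ refl (solve 2 (λ x y → y :+ y :+ :- (y :+ x) := y :- x) refl x y)
      (+-pos-nonneg (+-pos-nonneg 0<y (inj₁ 0<y)) (inj₁ (neg-pos y+x<0)))
    0<xx-yy : 0# < x * x - y * y
    0<xx-yy = <-resp₂ refl (solve 2 (λ x y → (y :- x) :* (:- (y :+ x)) := x :* x :- y :* y) refl x y)
      (*-pos 0<y-x (neg-pos y+x<0))

  nonneg-+-≈0 : ∀ {x y} → 0# ≤ x → 0# ≤ y → x + y ≈ 0# → x ≈ 0# × y ≈ 0#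
  nonneg-+-≈0 (inj₁ 0<x) 0≤y x+y≈0 = ⊥-elim (irrefl (sym x+y≈0) (+-pos-nonneg 0<x 0≤y))
  nonneg-+-≈0 {x} {y} (inj₂ 0≈x) 0≤y x+y≈0 =
    sym 0≈x , trans (sym (+-identityˡ y)) (trans (+-congʳ 0≈x) x+y≈0)

  nonneg-*-pos-≈0 : ∀ {x y} → 0# ≤ x → 0# < y → x * y ≈ 0# → x ≈ 0#
  nonneg-*-pos-≈0 (inj₁ 0<x) 0<y xy≈0 = ⊥-elim (irrefl (sym xy≈0) (*-pos 0<x 0<y))
  nonneg-*-pos-≈0 (inj₂ 0≈x) 0<y xy≈0 = sym 0≈x

  weights-of-positive-terms≈0 : ∀ {a b c d g₁ g₂ g₃ g₄} → 0# ≤ a → 0# ≤ b → 0# ≤ c → 0# ≤ d →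
                                0# ≤ g₁ → 0# < g₂ → 0# < g₃ → 0# ≤ g₄ →
                                a * g₁ + b * g₂ + c * g₃ + d * g₄ ≈ 0# → b ≈ 0# × c ≈ 0#
  weights-of-positive-terms≈0 {a} {b} {c} {d} {g₁} {g₂} {g₃} {g₄} 0≤a 0≤b 0≤c 0≤d 0≤g₁ 0<g₂ 0<g₃ 0≤g₄ Σ≈0 =
    nonneg-*-pos-≈0 0≤b 0<g₂ (proj₂ (nonneg-+-≈0 t₁ t₂ t₁₂≈0)) ,
    nonneg-*-pos-≈0 0≤c 0<g₃ (proj₂ (nonneg-+-≈0 (+-nonneg t₁ t₂) t₃ t₁₂₃≈0))
    where
    t₁ : 0# ≤ a * g₁
    t₁ = *-nonneg 0≤a 0≤g₁
    t₂ : 0# ≤ b * g₂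
    t₂ = *-nonneg 0≤b (inj₁ 0<g₂)
    t₃ : 0# ≤ c * g₃
    t₃ = *-nonneg 0≤c (inj₁ 0<g₃)
    t₄ : 0# ≤ d * g₄
    t₄ = *-nonneg 0≤d 0≤g₄
    t₁₂₃≈0 : a * g₁ + b * g₂ + c * g₃ ≈ 0#
    t₁₂₃≈0 = proj₁ (nonneg-+-≈0 (+-nonneg (+-nonneg t₁ t₂) t₃) t₄ Σ≈0)
    t₁₂≈0 : a * g₁ + b * g₂ ≈ 0#
    t₁₂≈0 = proj₁ (nonneg-+-≈0 (+-nonneg t₁ t₂) t₃ t₁₂₃≈0)

-- Parametrised by bare operations so that it can also be instantiated at the solver's polynomials,
-- which lets ring-solver goals be written in vector notation.
module PlaneVectors {a} {A : Set a} (_+_ _*_ _-_ : A → A → A) where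
  infixl 6 _+ᵥ_ _-ᵥ_
  infix 7 _·_ _∧_

  _+ᵥ_ _-ᵥ_ : A × A → A × A → A × A
  (x₁ , x₂) +ᵥ (y₁ , y₂) = x₁ + y₁ , x₂ + y₂
  (x₁ , x₂) -ᵥ (y₁ , y₂) = x₁ - y₁ , x₂ - y₂

  _·_ _∧_ : A × A → A × A → A
  (x₁ , x₂) · (y₁ , y₂) = (x₁ * y₁) + (x₂ * y₂)
  (x₁ , x₂) ∧ (y₁ , y₂) = (x₁ * y₂) - (x₂ * y₁)

  ∣_∣² : A × A → A
  ∣ x ∣² = x · x

module PlaneGeometry (R : OrderedCommutativeRing) where
  open OrderedCommutativeRing R
  open OrderedCommutativeRingProperties R
  open import Algebra.Properties.Group +-group using (x∙y⁻¹≈ε⇒x≈y)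
  open import Relation.Binary.Reasoning.Setoid setoid
  open PlaneVectors _+_ _*_ _-_ public
  module Symbolic {n} = PlaneVectors {A = Polynomial n} _:+_ _:*_ _:-_
  open Symbolic renaming (_+ᵥ_ to _:+ᵥ_; _-ᵥ_ to _:-ᵥ_; _·_ to _:·_; _∧_ to _:∧_; ∣_∣² to :∣_∣²)

  ∣-∣²-sym : ∀ u v → ∣ u -ᵥ v ∣² ≈ ∣ v -ᵥ u ∣²
  ∣-∣²-sym (u₁ , u₂) (v₁ , v₂) =
    solve 4 (λ u₁ u₂ v₁ v₂ → let u = u₁ , u₂; v = v₁ , v₂ in :∣ u :-ᵥ v ∣² := :∣ v :-ᵥ u ∣²) refl u₁ u₂ v₁ v₂

  ∣-∣²-translation : ∀ u v w → ∣ (u -ᵥ w) -ᵥ (v -ᵥ w) ∣² ≈ ∣ u -ᵥ v ∣²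
  ∣-∣²-translation (u₁ , u₂) (v₁ , v₂) (w₁ , w₂) =
    solve 6 (λ u₁ u₂ v₁ v₂ w₁ w₂ → let u = u₁ , u₂; v = v₁ , v₂; w = w₁ , w₂ in
      :∣ (u :-ᵥ w) :-ᵥ (v :-ᵥ w) ∣² := :∣ u :-ᵥ v ∣²) refl u₁ u₂ v₁ v₂ w₁ w₂

  ·-+ᵥ-comm : ∀ u v w → u · (v +ᵥ w) ≈ u · (w +ᵥ v)
  ·-+ᵥ-comm (u₁ , u₂) (v₁ , v₂) (w₁ , w₂) =
    solve 6 (λ u₁ u₂ v₁ v₂ w₁ w₂ → let u = u₁ , u₂; v = v₁ , v₂; w = w₁ , w₂ in
      u :· (v :+ᵥ w) := u :· (w :+ᵥ v)) refl u₁ u₂ v₁ v₂ w₁ w₂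

  polarisation : ∀ u v → 2# * (u · v) ≈ ∣ u ∣² + ∣ v ∣² - ∣ u -ᵥ v ∣²
  polarisation (u₁ , u₂) (v₁ , v₂) =
    solve 4 (λ u₁ u₂ v₁ v₂ → let u = u₁ , u₂; v = v₁ , v₂ in
      con (+ 2) :* (u :· v) := :∣ u ∣² :+ :∣ v ∣² :- :∣ u :-ᵥ v ∣²) refl u₁ u₂ v₁ v₂

  frame-decomposition : ∀ u v w → ∣ u ∣² * (v · w) ≈ (u · v) * (u · w) + (u ∧ v) * (u ∧ w)
  frame-decomposition (u₁ , u₂) (v₁ , v₂) (w₁ , w₂) =
    solve 6 (λ u₁ u₂ v₁ v₂ w₁ w₂ → let u = u₁ , u₂; v = v₁ , v₂; w = w₁ , w₂ in
      :∣ u ∣² :* (v :· w) := (u :· v) :* (u :· w) :+ (u :∧ v) :* (u :∧ w)) refl u₁ u₂ v₁ v₂ w₁ w₂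

  -- (p , s) and (r , t) make angles with the first axis whose tangents are at most √k and 1/√k in
  -- absolute value, so the angle between them is at most 90°.
  tangent-product-bound : ∀ {k p r s t} → 0# < k → 0# < p → 0# < r →
                          s * s ≤ k * (p * p) → k * (t * t) ≤ r * r → 0# ≤ p * r + s * t
  tangent-product-bound {k} {p} {r} {s} {t} 0<k 0<p 0<r s²≤kp² kt²≤r² =
    x*x≤y*y⇒0≤y+x (*-pos 0<p 0<r) (*-cancelˡ-≤-pos 0<k (≤-resp₂ regroupˡ regroupʳ
      (*-mono-≤-nonneg (square-nonneg s) (*-nonneg (inj₁ 0<k) (square-nonneg t)) s²≤kp² kt²≤r²)))
    where
    regroupˡ : (s * s) * (k * (t * t)) ≈ k * ((s * t) * (s * t))
    regroupˡ = solve 3 (λ s t k → (s :* s) :* (k :* (t :* t)) := k :* ((s :* t) :* (s :* t))) refl s t k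
    regroupʳ : (k * (p * p)) * (r * r) ≈ k * ((p * r) * (p * r))
    regroupʳ = solve 3 (λ p r k → (k :* (p :* p)) :* (r :* r) := k :* ((p :* r) :* (p :* r))) refl p r k

  -- Read through tan² ∠(u , v) = (u ∧ v)² / (u · v)²: the angle between u and v is at most 60° and
  -- (next lemma) the angle between u and u + v is at most 30°.
  angle≤60° : ∀ u v → 1# ≤ ∣ u ∣² → 1# ≤ ∣ v ∣² → ∣ u -ᵥ v ∣² ≈ 1# →
              0# < u · v × (u ∧ v) * (u ∧ v) ≤ 3# * ((u · v) * (u · v))
  angle≤60° u@(u₁ , u₂) v@(v₁ , v₂) 1≤A 1≤B E≈1 =
    0<u·v , 0≤y-x⇒x≤y (≤-resp₂ refl (sym certificate) 0≤rhs)
    where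
    A B a b : Carrier
    A = ∣ u ∣²
    B = ∣ v ∣²
    a = A - 1#
    b = B - 1#
    0≤a : 0# ≤ a
    0≤a = x≤y⇒0≤y-x 1≤A
    0≤b : 0# ≤ b
    0≤b = x≤y⇒0≤y-x 1≤B
    E-cong : ∀ {x} → x - ∣ u -ᵥ v ∣² ≈ x - 1#
    E-cong = +-congˡ (-‿cong E≈1)
    0<u·v : 0# < u · v
    0<u·v = *-cancelˡ-pos 0<2# (<-resp₂ refl (sym (begin
      2# * (u · v)        ≈⟨ polarisation u v ⟩
      A + B - ∣ u -ᵥ v ∣² ≈⟨ E-cong ⟩
      A + B - 1#          ≈⟨ solve 2 (λ A B → A :+ B :- con (+ 1) := B :+ (A :- con (+ 1))) refl A B ⟩
      B + a               ∎)) (+-pos-nonneg (1≤x⇒0<x 1≤B) 0≤a))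
    certificate : 3# * ((u · v) * (u · v)) - (u ∧ v) * (u ∧ v) ≈ a * a + a * b + b * b + a + b
    certificate = begin
      3# * ((u · v) * (u · v)) - (u ∧ v) * (u ∧ v)
        ≈⟨ solve 4 (λ u₁ u₂ v₁ v₂ → let u = u₁ , u₂; v = v₁ , v₂; d = :∣ u ∣² :+ :∣ v ∣² :- :∣ u :-ᵥ v ∣² in
             con (+ 3) :* ((u :· v) :* (u :· v)) :- (u :∧ v) :* (u :∧ v) := d :* d :- :∣ u ∣² :* :∣ v ∣²)
             refl u₁ u₂ v₁ v₂ ⟩
      (A + B - ∣ u -ᵥ v ∣²) * (A + B - ∣ u -ᵥ v ∣²) - A * B
        ≈⟨ +-congʳ (*-cong E-cong E-cong) ⟩
      (A + B - 1#) * (A + B - 1#) - A * B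
        ≈⟨ solve 2 (λ A B → let a = A :- con (+ 1); b = B :- con (+ 1) in
             (A :+ B :- con (+ 1)) :* (A :+ B :- con (+ 1)) :- A :* B
             := a :* a :+ a :* b :+ b :* b :+ a :+ b) refl A B ⟩
      a * a + a * b + b * b + a + b ∎
    0≤rhs : 0# ≤ a * a + a * b + b * b + a + b
    0≤rhs = +-nonneg (+-nonneg (+-nonneg (+-nonneg (square-nonneg a) (*-nonneg 0≤a 0≤b))
                                          (square-nonneg b)) 0≤a) 0≤b

  angle-with-sum≤30° : ∀ u v → 1# ≤ ∣ u ∣² → 1# ≤ ∣ v ∣² → ∣ u -ᵥ v ∣² ≈ 1# →
                       0# < u · (u +ᵥ v) ×
                       3# * ((u ∧ (u +ᵥ v)) * (u ∧ (u +ᵥ v))) ≤ (u · (u +ᵥ v)) * (u · (u +ᵥ v))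
  angle-with-sum≤30° u@(u₁ , u₂) v@(v₁ , v₂) 1≤A 1≤C E≈1 =
    0<W , 0≤y-x⇒x≤y (*-cancelˡ-nonneg 0<4# (≤-resp₂ refl (sym certificate) 0≤rhs))
    where
    A C a c W T : Carrier
    A = ∣ u ∣²
    C = ∣ v ∣²
    a = A - 1#
    c = C - 1#
    W = u · (u +ᵥ v)
    T = u ∧ (u +ᵥ v)
    0≤a : 0# ≤ a
    0≤a = x≤y⇒0≤y-x 1≤A
    E-cong : ∀ {x} → x - ∣ u -ᵥ v ∣² ≈ x - 1#
    E-cong = +-congˡ (-‿cong E≈1)
    0<W : 0# < W
    0<W = *-cancelˡ-pos 0<2# (<-resp₂ refl (sym (begin
      2# * W                   ≈⟨ solve 4 (λ u₁ u₂ v₁ v₂ → let u = u₁ , u₂; v = v₁ , v₂ in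
                                    con (+ 2) :* (u :· (u :+ᵥ v))
                                    := con (+ 3) :* :∣ u ∣² :+ :∣ v ∣² :- :∣ u :-ᵥ v ∣²) refl u₁ u₂ v₁ v₂ ⟩
      3# * A + C - ∣ u -ᵥ v ∣² ≈⟨ E-cong ⟩
      3# * A + C - 1#          ≈⟨ +-assoc _ _ _ ⟩
      3# * A + c               ∎)) (+-pos-nonneg (*-pos 0<3# (1≤x⇒0<x 1≤A)) (x≤y⇒0≤y-x 1≤C)))
    certificate : 4# * (W * W - 3# * (T * T)) ≈ 4# * (3# * (a * a) + c * c + 3# * a)
    certificate = begin
      4# * (W * W - 3# * (T * T))
        ≈⟨ solve 4 (λ u₁ u₂ v₁ v₂ → let u = u₁ , u₂; v = v₁ , v₂; W = u :· (u :+ᵥ v); T = u :∧ (u :+ᵥ v)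
                                        A = :∣ u ∣²; C = :∣ v ∣²; E = :∣ u :-ᵥ v ∣² in
             con (+ 4) :* (W :* W :- con (+ 3) :* (T :* T))
             := (con (+ 3) :* A :+ C :- E) :* (con (+ 3) :* A :+ C :- E)
                :- con (+ 3) :* (con (+ 4) :* (A :* C) :- (A :+ C :- E) :* (A :+ C :- E))) refl u₁ u₂ v₁ v₂ ⟩
      (3# * A + C - ∣ u -ᵥ v ∣²) * (3# * A + C - ∣ u -ᵥ v ∣²)
        - 3# * (4# * (A * C) - (A + C - ∣ u -ᵥ v ∣²) * (A + C - ∣ u -ᵥ v ∣²))
        ≈⟨ +-cong (*-cong E-cong E-cong) (-‿cong (*-congˡ (+-congˡ (-‿cong (*-cong E-cong E-cong))))) ⟩
      (3# * A + C - 1#) * (3# * A + C - 1#) - 3# * (4# * (A * C) - (A + C - 1#) * (A + C - 1#))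
        ≈⟨ solve 2 (λ A C → let a = A :- con (+ 1); c = C :- con (+ 1) in
             (con (+ 3) :* A :+ C :- con (+ 1)) :* (con (+ 3) :* A :+ C :- con (+ 1))
             :- con (+ 3) :* (con (+ 4) :* (A :* C) :- (A :+ C :- con (+ 1)) :* (A :+ C :- con (+ 1)))
             := con (+ 4) :* (con (+ 3) :* (a :* a) :+ c :* c :+ con (+ 3) :* a)) refl A C ⟩
      4# * (3# * (a * a) + c * c + 3# * a) ∎
    0≤rhs : 0# ≤ 4# * (3# * (a * a) + c * c + 3# * a)
    0≤rhs = *-nonneg (inj₁ 0<4#) (+-nonneg (+-nonneg (*-nonneg (inj₁ 0<3#) (square-nonneg a)) (square-nonneg c))
                                             (*-nonneg (inj₁ 0<3#) 0≤a))

  unit-path-·-nonneg : ∀ x y z → 1# ≤ ∣ x ∣² → 1# ≤ ∣ y ∣² → 1# ≤ ∣ z ∣² →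
                       ∣ y -ᵥ x ∣² ≈ 1# → ∣ y -ᵥ z ∣² ≈ 1# → 0# ≤ x · (y +ᵥ z)
  unit-path-·-nonneg x y z 1≤∣x∣² 1≤∣y∣² 1≤∣z∣² ∣y-x∣²≈1 ∣y-z∣²≈1 =
    *-cancelˡ-nonneg (1≤x⇒0<x 1≤∣y∣²) (≤-resp₂ refl (sym (frame-decomposition y x (y +ᵥ z)))
      (tangent-product-bound 0<3# (proj₁ ∠yx) (proj₁ ∠yw) (proj₂ ∠yx) (proj₂ ∠yw)))
    where
    ∠yx : 0# < y · x × (y ∧ x) * (y ∧ x) ≤ 3# * ((y · x) * (y · x))
    ∠yx = angle≤60° y x 1≤∣y∣² 1≤∣x∣² ∣y-x∣²≈1
    ∠yw : 0# < y · (y +ᵥ z) × 3# * ((y ∧ (y +ᵥ z)) * (y ∧ (y +ᵥ z))) ≤ (y · (y +ᵥ z)) * (y · (y +ᵥ z))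
    ∠yw = angle-with-sum≤30° y z 1≤∣y∣² 1≤∣z∣² ∣y-z∣²≈1

  barycentre-centred : ∀ {a b c d x x₁ x₂ x₃ x₄} → a + b + c + d ≈ 1# →
                       x ≈ a * x₁ + b * x₂ + c * x₃ + d * x₄ →
                       a * (x₁ - x) + b * (x₂ - x) + c * (x₃ - x) + d * (x₄ - x) ≈ 0#
  barycentre-centred {a} {b} {c} {d} {x} {x₁} {x₂} {x₃} {x₄} Σ≈1 x≈Σ = begin
    a * (x₁ - x) + b * (x₂ - x) + c * (x₃ - x) + d * (x₄ - x)
      ≈⟨ solve 9 (λ a b c d x x₁ x₂ x₃ x₄ →
           a :* (x₁ :- x) :+ b :* (x₂ :- x) :+ c :* (x₃ :- x) :+ d :* (x₄ :- x)
           := (a :* x₁ :+ b :* x₂ :+ c :* x₃ :+ d :* x₄) :- (a :+ b :+ c :+ d) :* x) refl a b c d x x₁ x₂ x₃ x₄ ⟩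
    (a * x₁ + b * x₂ + c * x₃ + d * x₄) - (a + b + c + d) * x ≈⟨ +-cong (sym x≈Σ) (-‿cong (*-congʳ Σ≈1)) ⟩
    x - 1# * x                                              ≈⟨ solve 1 (λ x → x :- con (+ 1) :* x := con (+ 0)) refl x ⟩
    0#                                                      ∎

  weighted-·≈0 : ∀ {a b c d} u₁ u₂ u₃ u₄ w →
                 a * proj₁ u₁ + b * proj₁ u₂ + c * proj₁ u₃ + d * proj₁ u₄ ≈ 0# →
                 a * proj₂ u₁ + b * proj₂ u₂ + c * proj₂ u₃ + d * proj₂ u₄ ≈ 0# →
                 a * (u₁ · w) + b * (u₂ · w) + c * (u₃ · w) + d * (u₄ · w) ≈ 0#
  weighted-·≈0 {a} {b} {c} {d} (x₁ , y₁) (x₂ , y₂) (x₃ , y₃) (x₄ , y₄) (w₁ , w₂) X≈0 Y≈0 = begin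
    a * (u₁ · w) + b * (u₂ · w) + c * (u₃ · w) + d * (u₄ · w)
      ≈⟨ solve 14 (λ a b c d x₁ y₁ x₂ y₂ x₃ y₃ x₄ y₄ w₁ w₂ →
           let w = w₁ , w₂ in
           a :* ((x₁ , y₁) :· w) :+ b :* ((x₂ , y₂) :· w) :+ c :* ((x₃ , y₃) :· w) :+ d :* ((x₄ , y₄) :· w)
           := (a :* x₁ :+ b :* x₂ :+ c :* x₃ :+ d :* x₄) :* w₁ :+ (a :* y₁ :+ b :* y₂ :+ c :* y₃ :+ d :* y₄) :* w₂)
           refl a b c d x₁ y₁ x₂ y₂ x₃ y₃ x₄ y₄ w₁ w₂ ⟩
    (a * x₁ + b * x₂ + c * x₃ + d * x₄) * w₁ + (a * y₁ + b * y₂ + c * y₃ + d * y₄) * w₂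
      ≈⟨ +-cong (*-congʳ X≈0) (*-congʳ Y≈0) ⟩
    0# * w₁ + 0# * w₂ ≈⟨ solve 2 (λ w₁ w₂ → con (+ 0) :* w₁ :+ con (+ 0) :* w₂ := con (+ 0)) refl w₁ w₂ ⟩
    0# ∎
    where
    u₁ u₂ u₃ u₄ w : Carrier × Carrier
    u₁ = x₁ , y₁
    u₂ = x₂ , y₂
    u₃ = x₃ , y₃
    u₄ = x₄ , y₄
    w = w₁ , w₂

  affine-dependence⇒parallel : ∀ {a d u₁ u₂ w₁ w₂} → a + d ≈ 1# →
                               a * u₁ + d * w₁ ≈ 0# → a * u₂ + d * w₂ ≈ 0# → u₁ * w₂ ≈ u₂ * w₁
  affine-dependence⇒parallel {a} {d} {u₁} {u₂} {w₁} {w₂} a+d≈1 X≈0 Y≈0 = x∙y⁻¹≈ε⇒x≈y _ _ (begin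
    u₁ * w₂ - u₂ * w₁                      ≈⟨ *-identityˡ _ ⟨
    1# * (u₁ * w₂ - u₂ * w₁)               ≈⟨ *-congʳ a+d≈1 ⟨
    (a + d) * (u₁ * w₂ - u₂ * w₁)          ≈⟨ solve 6 (λ a d u₁ u₂ w₁ w₂ →
                                                let X = a :* u₁ :+ d :* w₁; Y = a :* u₂ :+ d :* w₂ in
                                                (a :+ d) :* (u₁ :* w₂ :- u₂ :* w₁)
                                                := w₂ :* X :- w₁ :* Y :+ (u₁ :* Y :- u₂ :* X)) refl a d u₁ u₂ w₁ w₂ ⟩
    w₂ * X - w₁ * Y + (u₁ * Y - u₂ * X)    ≈⟨ +-cong (+-cong (*-congˡ X≈0) (-‿cong (*-congˡ Y≈0)))
                                                      (+-cong (*-congˡ Y≈0) (-‿cong (*-congˡ X≈0))) ⟩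
    w₂ * 0# - w₁ * 0# + (u₁ * 0# - u₂ * 0#) ≈⟨ solve 4 (λ u₁ u₂ w₁ w₂ → let o = con (+ 0) in
                                                 w₂ :* o :- w₁ :* o :+ (u₁ :* o :- u₂ :* o) := o) refl u₁ u₂ w₁ w₂ ⟩
    0#                                     ∎)
    where
    X Y : Carrier
    X = a * u₁ + d * w₁
    Y = a * u₂ + d * w₂

module _ (R : CompleteOrderedField) where
  open Plane R using (dist²; Collinear; InConvexHull4)
  private O = orderedCommutativeRing R
  open OrderedCommutativeRing O
  open OrderedCommutativeRingProperties O
  open PlaneGeometry O

  unit-path-hull⇒collinear : ∀ v p₁ p₂ p₃ p₄ →
    1# ≤ dist² v p₁ → 1# ≤ dist² v p₂ → 1# ≤ dist² v p₃ → 1# ≤ dist² v p₄ →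
    dist² p₁ p₂ ≈ 1# → dist² p₂ p₃ ≈ 1# → dist² p₃ p₄ ≈ 1# →
    InConvexHull4 v p₁ p₂ p₃ p₄ → Collinear v p₁ p₄
  unit-path-hull⇒collinear v p₁ p₂ p₃ p₄ d₁ d₂ d₃ d₄ e₁₂ e₂₃ e₃₄
    (a , b , c , d , 0≤a , 0≤b , 0≤c , 0≤d , Σ≈1 , vˣ≈Σ , vʸ≈Σ) =
    affine-dependence⇒parallel (trans (sym (drop-middle b≈0 c≈0)) Σ≈1)
      (trans (sym (drop-middle (zero-weight b≈0) (zero-weight c≈0))) Σˣ≈0)
      (trans (sym (drop-middle (zero-weight b≈0) (zero-weight c≈0))) Σʸ≈0)
    where
    u₁ u₂ u₃ u₄ w : Carrier × Carrier
    u₁ = p₁ -ᵥ v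
    u₂ = p₂ -ᵥ v
    u₃ = p₃ -ᵥ v
    u₄ = p₄ -ᵥ v
    w = u₂ +ᵥ u₃

    far : ∀ {p} → 1# ≤ dist² v p → 1# ≤ ∣ p -ᵥ v ∣²
    far {p} = ≤-resp₂ refl (∣-∣²-sym v p)
    unit : ∀ {p q} → dist² p q ≈ 1# → ∣ (p -ᵥ v) -ᵥ (q -ᵥ v) ∣² ≈ 1#
    unit {p} {q} = trans (∣-∣²-translation p q v)
    unit′ : ∀ {p q} → dist² p q ≈ 1# → ∣ (q -ᵥ v) -ᵥ (p -ᵥ v) ∣² ≈ 1#
    unit′ {p} {q} = trans (trans (∣-∣²-translation q p v) (∣-∣²-sym q p))

    0≤u₁·w : 0# ≤ u₁ · w
    0≤u₁·w = unit-path-·-nonneg u₁ u₂ u₃ (far d₁) (far d₂) (far d₃) (unit′ e₁₂) (unit e₂₃)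
    0<u₂·w : 0# < u₂ · w
    0<u₂·w = proj₁ (angle-with-sum≤30° u₂ u₃ (far d₂) (far d₃) (unit e₂₃))
    0<u₃·w : 0# < u₃ · w
    0<u₃·w = <-resp₂ refl (·-+ᵥ-comm u₃ u₃ u₂)
      (proj₁ (angle-with-sum≤30° u₃ u₂ (far d₃) (far d₂) (unit′ e₂₃)))
    0≤u₄·w : 0# ≤ u₄ · w
    0≤u₄·w = ≤-resp₂ refl (·-+ᵥ-comm u₄ u₃ u₂)
      (unit-path-·-nonneg u₄ u₃ u₂ (far d₄) (far d₃) (far d₂) (unit e₃₄) (unit′ e₂₃))

    Σˣ≈0 : a * proj₁ u₁ + b * proj₁ u₂ + c * proj₁ u₃ + d * proj₁ u₄ ≈ 0#
    Σˣ≈0 = barycentre-centred Σ≈1 vˣ≈Σ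
    Σʸ≈0 : a * proj₂ u₁ + b * proj₂ u₂ + c * proj₂ u₃ + d * proj₂ u₄ ≈ 0#
    Σʸ≈0 = barycentre-centred Σ≈1 vʸ≈Σ

    b≈0×c≈0 : b ≈ 0# × c ≈ 0#
    b≈0×c≈0 = weights-of-positive-terms≈0 0≤a 0≤b 0≤c 0≤d 0≤u₁·w 0<u₂·w 0<u₃·w 0≤u₄·w
                (weighted-·≈0 u₁ u₂ u₃ u₄ w Σˣ≈0 Σʸ≈0)
    b≈0 : b ≈ 0#
    b≈0 = proj₁ b≈0×c≈0
    c≈0 : c ≈ 0#
    c≈0 = proj₂ b≈0×c≈0

    zero-weight : ∀ {x y} → x ≈ 0# → x * y ≈ 0#
    zero-weight {x} {y} x≈0 = trans (*-congʳ x≈0) (zeroˡ y)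
    drop-middle : ∀ {x y z t} → y ≈ 0# → z ≈ 0# → x + y + z + t ≈ x + t
    drop-middle {x} {y} {z} {t} y≈0 z≈0 = trans (+-congʳ (+-cong (+-congˡ y≈0) z≈0))
      (solve 2 (λ x t → x :+ con (+ 0) :+ con (+ 0) :+ t := x :+ t) refl x t)

lemma10 : (R : CompleteOrderedField) → let open Plane R in
    (n : ℕ) (p : Fin n → Point) →
    IsPennyConfiguration p → GeneralPosition p →
    (b₁ b₂ b₃ b₄ : Fin n) →
    ¬ (b₁ ≡ b₂) → ¬ (b₁ ≡ b₃) → ¬ (b₁ ≡ b₄) → ¬ (b₂ ≡ b₃) → ¬ (b₂ ≡ b₄) → ¬ (b₃ ≡ b₄) →
    Edge p b₁ b₂ → Edge p b₂ b₃ → Edge p b₃ b₄ →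
    (v : Fin n) → ¬ (v ≡ b₁) → ¬ (v ≡ b₂) → ¬ (v ≡ b₃) → ¬ (v ≡ b₄) →
    ¬ InConvexHull4 (p v) (p b₁) (p b₂) (p b₃) (p b₄)
lemma10 R n p penny general b₁ b₂ b₃ b₄ b₁≢b₂ b₁≢b₃ b₁≢b₄ b₂≢b₃ b₂≢b₄ b₃≢b₄ e₁₂ e₂₃ e₃₄
        v v≢b₁ v≢b₂ v≢b₃ v≢b₄ v∈hull =
  general v b₁ b₄ v≢b₁ b₁≢b₄ v≢b₄
    (unit-path-hull⇒collinear R (p v) (p b₁) (p b₂) (p b₃) (p b₄)
      (penny v b₁ v≢b₁) (penny v b₂ v≢b₂) (penny v b₃ v≢b₃) (penny v b₄ v≢b₄) e₁₂ e₂₃ e₃₄ v∈hull)
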